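{- If $G$ is a finite simple connected graph with $n(G)\geq 2$ vertices, then $$\operatorname{sg}(G) \geq \left\lceil \frac{1+\sqrt{1+\frac{8\,n(G)}{\operatorname{diam}(G)+1}}}{2}\right\rceil.$$
   Context: For a graph $G=(V,E)$ and a set $S\subseteq V$, for each pair of distinct vertices $\{x,y\}\subseteq S$ one selects one fixed shortest $x,y$-path $\widetilde g(x,y)$. The set $S$ is a strong geodetic set if for some such choice of fixed shortest paths, every vertex of $G$ lies on at least one of the selected paths. The strong geodetic number $\operatorname{sg}(G)$ is the minimum cardinality of a strong geodetic set of $G$. $n(G)$ is the number of vertices and $\operatorname{diam}(G)$ the diameter of $G$. -}

module Defs where

open import Data.Nat using (ℕ; zero; suc; _+_; _*_; _∸_; _^_; _≤_; _≤?_)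
open import Data.Fin using (Fin) renaming (_<_ to _<ᶠ_)
open import Data.Fin.Subset using (Subset; _∈_; ∣_∣)
open import Data.Product using (Σ; Σ-syntax; ∃; ∃-syntax; _×_; _,_)
open import Relation.Nullary using (¬_; Dec; yes; no)
open import Relation.Binary.PropositionalEquality using (_≡_)

record Graph (n : ℕ) : Set₁ where
  field
    Adj     : Fin n → Fin n → Set
    Adj-dec : ∀ x y → Dec (Adj x y)
    sym     : ∀ {x y} → Adj x y → Adj y x
    irrefl  : ∀ {x} → ¬ Adj x x

module _ {n : ℕ} (G : Graph n) where
  open Graph G

  data Walk : Fin n → Fin n → ℕ → Set where
    here : ∀ x → Walk x x 0
    step : ∀ {x y z ℓ} → Adj x y → Walk y z ℓ → Walk x z (suc ℓ)

  data OnWalk (v : Fin n) : ∀ {x y ℓ} → Walk x y ℓ → Set where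
    on-here  : OnWalk v (here v)
    on-head  : ∀ {y z ℓ} (a : Adj v y) (w : Walk y z ℓ) → OnWalk v (step a w)
    on-there : ∀ {x y z ℓ} (a : Adj x y) {w : Walk y z ℓ} → OnWalk v w → OnWalk v (step a w)

  record Geodesic (x y : Fin n) : Set where
    field
      len      : ℕ
      walk     : Walk x y len
      shortest : ∀ ℓ → Walk x y ℓ → len ≤ ℓ

  Dist : Fin n → Fin n → ℕ → Set
  Dist x y d = Walk x y d × (∀ ℓ → Walk x y ℓ → d ≤ ℓ)

  Connected : Set
  Connected = ∀ x y → ∃[ ℓ ] Walk x y ℓ

  IsDiameter : ℕ → Set
  IsDiameter D = (∀ x y d → Dist x y d → d ≤ D) × (∃[ x ] ∃[ y ] Dist x y D)

  -- S is a strong geodetic set: one fixed geodesic per unordered pair {x,y}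
  -- (indexed by x < y), covering all vertices.
  IsStrongGeodetic : Subset n → Set
  IsStrongGeodetic S =
    Σ[ g ∈ (∀ x y → x ∈ S → y ∈ S → x <ᶠ y → Geodesic x y) ]
      (∀ v → ∃[ x ] ∃[ y ] Σ[ px ∈ x ∈ S ] Σ[ py ∈ y ∈ S ] Σ[ lt ∈ x <ᶠ y ]
               OnWalk v (Geodesic.walk (g x y px py lt)))

  IsSG : ℕ → Set
  IsSG k = (Σ[ S ∈ Subset n ] IsStrongGeodetic S × ∣ S ∣ ≡ k)
         × (∀ S → IsStrongGeodetic S → k ≤ ∣ S ∣)

-- The bound ⌈(1 + √(1 + 8n/(D+1)))/2⌉ without reals.
-- For k ∈ ℕ:  k ≥ (1 + √(1 + 8n/(D+1)))/2
--   ⇔ 2k - 1 ≥ 0  and  (2k-1)² ≥ 1 + 8n/(D+1)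
--   ⇔ 1 ≤ 2k      and  (D+1) + 8n ≤ (2k ∸ 1)² (D+1).
AboveBound : ℕ → ℕ → ℕ → Set
AboveBound n D k = (1 ≤ 2 * k) × ((D + 1) + 8 * n ≤ ((2 * k ∸ 1) ^ 2) * (D + 1))

aboveBound? : ∀ n D k → Dec (AboveBound n D k)
aboveBound? n D k with 1 ≤? 2 * k | (D + 1) + 8 * n ≤? ((2 * k ∸ 1) ^ 2) * (D + 1)
... | yes p | yes q = yes (p , q)
... | no ¬p | _     = no λ { (p , _) → ¬p p }
... | yes _ | no ¬q = no λ { (_ , q) → ¬q q }

leastFrom : ℕ → ℕ → ℕ → ℕ → ℕ
leastFrom n D zero     k = k
leastFrom n D (suc f)  k with aboveBound? n D k
... | yes _ = k
... | no  _ = leastFrom n D f (suc k)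

-- ⌈(1 + √(1 + 8n/(D+1)))/2⌉ : the least natural k ≥ the real bound.
-- (k = n + 1 always satisfies AboveBound, so fuel 2n+2 suffices.)
ceilBound : ℕ → ℕ → ℕ
ceilBound n D = leastFrom n D (2 * n + 2) 0

{-# OPTIONS --safe #-}
-- Each geodesic of G has at most diam(G) + 1 vertices, and a strong geodetic set S
-- fixes one geodesic for each of its C(|S|,2) pairs; since these paths cover V(G),
-- n ≤ C(sg,2)·(diam + 1). Because (2k − 1)² = 1 + 8·C(k,2), this is exactly the
-- statement that sg(G) lies above (1 + √(1 + 8n/(diam + 1)))/2.
module Submission where

open import Defs
open import Data.Nat using (ℕ; zero; suc; _+_; _*_; _∸_; _^_; _≤_; _<_; z≤n; s≤s)
open import Data.Nat.Properties
open import Data.Nat.Combinatorics using (_C_; nC1≡n; nCk+nC[k+1]≡[n+1]C[k+1])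
open import Data.Nat.Tactic.RingSolver using (solve-∀)
open import Data.Fin as Fin using (Fin; toℕ) renaming (_<_ to _<ᶠ_)
open import Data.Fin.Properties using (pigeonhole)
  renaming (_<?_ to _<ᶠ?_; <-irrelevant to <ᶠ-irrelevant)
open import Data.Fin.Subset using (Subset; _∈_; ∣_∣; inside; outside)
open import Data.Fin.Subset.Properties using (_∈?_)
open import Data.Vec using ([]; _∷_; here; there)
open import Data.Vec.Properties.WithK using ([]=-irrelevant)
open import Data.List using (List; []; _∷_; _++_; map; length; concatMap; lookup)
open import Data.List.Properties using (length-++; length-map)
open import Data.List.Relation.Unary.Any as Any using (here; there)
open import Data.List.Relation.Unary.Any.Properties using (lookup-index; ++⁺ˡ; ++⁺ʳ; map⁺)
open import Data.List.Membership.Propositional using () renaming (_∈_ to _∈ₗ_)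
open import Data.List.Membership.Propositional.Properties using (∈-concatMap⁺)
open import Data.Product as × using (_×_; _,_)
open import Data.Sum using (inj₁; inj₂)
open import Relation.Nullary using (yes; no; contradiction)
open import Relation.Binary.PropositionalEquality

leastFrom-minimal : ∀ {n D k} f s → AboveBound n D k → s ≤ k → leastFrom n D f s ≤ k
leastFrom-minimal zero    s above s≤k = s≤k
leastFrom-minimal {n} {D} (suc f) s above s≤k with aboveBound? n D s
... | yes _    = s≤k
... | no ¬above with m≤n⇒m<n∨m≡n s≤k
...   | inj₁ s<k  = leastFrom-minimal f (suc s) above s<k
...   | inj₂ refl = contradiction above ¬above

ceilBound-minimal : ∀ {n D k} → AboveBound n D k → ceilBound n D ≤ k
ceilBound-minimal {n} above = leastFrom-minimal (2 * n + 2) 0 above z≤n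

2*[1+m]C2≡m*[1+m] : ∀ m → 2 * (suc m C 2) ≡ m * suc m
2*[1+m]C2≡m*[1+m] zero    = refl
2*[1+m]C2≡m*[1+m] (suc m) = begin
  2 * (suc (suc m) C 2)         ≡⟨ cong (2 *_) (nCk+nC[k+1]≡[n+1]C[k+1] (suc m) 1) ⟨
  2 * (suc m C 1 + suc m C 2)   ≡⟨ cong (λ c → 2 * (c + suc m C 2)) (nC1≡n (suc m)) ⟩
  2 * (suc m + suc m C 2)       ≡⟨ *-distribˡ-+ 2 (suc m) (suc m C 2) ⟩
  2 * suc m + 2 * (suc m C 2)   ≡⟨ cong (2 * suc m +_) (2*[1+m]C2≡m*[1+m] m) ⟩
  2 * suc m + m * suc m         ≡⟨ expand m ⟩
  suc m * suc (suc m)           ∎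
  where
  open ≡-Reasoning
  expand : ∀ m → 2 * (1 + m) + m * (1 + m) ≡ (1 + m) * (2 + m)
  expand = solve-∀

[2[1+m]∸1]²≡1+8*[1+m]C2 : ∀ m → (2 * suc m ∸ 1) ^ 2 ≡ 1 + 8 * (suc m C 2)
[2[1+m]∸1]²≡1+8*[1+m]C2 m = begin
  (2 * suc m ∸ 1) ^ 2           ≡⟨ cong (λ t → (t ∸ 1) ^ 2) (*-suc 2 m) ⟩
  (1 + 2 * m) ^ 2               ≡⟨ square m ⟩
  1 + 4 * (m * suc m)           ≡⟨ cong (λ t → 1 + 4 * t) (2*[1+m]C2≡m*[1+m] m) ⟨
  1 + 4 * (2 * (suc m C 2))     ≡⟨ cong (1 +_) (*-assoc 4 2 (suc m C 2)) ⟨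
  1 + 8 * (suc m C 2)           ∎
  where
  open ≡-Reasoning
  square : ∀ m → (1 + 2 * m) * ((1 + 2 * m) * 1) ≡ 1 + 4 * (m * (1 + m))
  square = solve-∀

n≤kC2*[1+D]⇒AboveBound : ∀ {n D} k → 0 < n → n ≤ (k C 2) * suc D → AboveBound n D k
n≤kC2*[1+D]⇒AboveBound zero 0<n n≤0 = contradiction n≤0 (<⇒≱ 0<n)
n≤kC2*[1+D]⇒AboveBound {n} {D} (suc m) _ n≤c = s≤s z≤n , (begin
  (D + 1) + 8 * n                       ≤⟨ +-monoʳ-≤ (D + 1) (*-monoʳ-≤ 8 n≤c) ⟩
  (D + 1) + 8 * ((suc m C 2) * suc D)   ≡⟨ factor (suc m C 2) D ⟩
  (1 + 8 * (suc m C 2)) * (D + 1)       ≡⟨ cong (_* (D + 1)) ([2[1+m]∸1]²≡1+8*[1+m]C2 m) ⟨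
  (2 * suc m ∸ 1) ^ 2 * (D + 1)         ∎)
  where
  open ≤-Reasoning
  factor : ∀ c D → (D + 1) + 8 * (c * (1 + D)) ≡ (1 + 8 * c) * (D + 1)
  factor = solve-∀

length-concatMap-≤ : ∀ {A B : Set} (f : A → List B) {c} → (∀ a → length (f a) ≤ c) →
                     ∀ xs → length (concatMap f xs) ≤ length xs * c
length-concatMap-≤ f     bound []       = z≤n
length-concatMap-≤ f {c} bound (x ∷ xs) = begin
  length (f x ++ concatMap f xs)           ≡⟨ length-++ (f x) ⟩
  length (f x) + length (concatMap f xs)   ≤⟨ +-mono-≤ (bound x) (length-concatMap-≤ f bound xs) ⟩
  c + length xs * c                        ∎
  where open ≤-Reasoning

enumeration⇒n≤length : ∀ {n} (xs : List (Fin n)) → (∀ v → v ∈ₗ xs) → n ≤ length xs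
enumeration⇒n≤length {n} xs enum with n ≤? length xs
... | yes n≤len = n≤len
... | no  n≰len with pigeonhole (≰⇒> n≰len) (λ v → Any.index (enum v))
...   | i , j , i<j , same-index = contradiction (cong toℕ i≡j) (<⇒≢ i<j)
  where
  i≡j : i ≡ j
  i≡j = begin
    i                            ≡⟨ lookup-index (enum i) ⟩
    lookup xs (Any.index (enum i)) ≡⟨ cong (lookup xs) same-index ⟩
    lookup xs (Any.index (enum j)) ≡⟨ lookup-index (enum j) ⟨
    j                            ∎
    where open ≡-Reasoning

elements : ∀ {n} → Subset n → List (Fin n)
elements []            = []
elements (inside  ∷ S) = Fin.zero ∷ map Fin.suc (elements S)
elements (outside ∷ S) = map Fin.suc (elements S)

length-elements : ∀ {n} (S : Subset n) → length (elements S) ≡ ∣ S ∣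
length-elements []            = refl
length-elements (inside  ∷ S) = cong suc (trans (length-map Fin.suc (elements S)) (length-elements S))
length-elements (outside ∷ S) = trans (length-map Fin.suc (elements S)) (length-elements S)

∈⇒∈elements : ∀ {n} {S : Subset n} {x} → x ∈ S → x ∈ₗ elements S
∈⇒∈elements {S = inside  ∷ S} here       = here refl
∈⇒∈elements {S = inside  ∷ S} (there x∈S) = there (map⁺ (Any.map (cong Fin.suc) (∈⇒∈elements x∈S)))
∈⇒∈elements {S = outside ∷ S} (there x∈S) = map⁺ (Any.map (cong Fin.suc) (∈⇒∈elements x∈S))

increasingPairs : ∀ {n} → Subset n → List (Fin n × Fin n)
increasingPairs []            = []
increasingPairs (inside  ∷ S) =
  map (λ y → Fin.zero , Fin.suc y) (elements S) ++ map (×.map Fin.suc Fin.suc) (increasingPairs S)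
increasingPairs (outside ∷ S) = map (×.map Fin.suc Fin.suc) (increasingPairs S)

length-increasingPairs : ∀ {n} (S : Subset n) → length (increasingPairs S) ≡ ∣ S ∣ C 2
length-increasingPairs []            = refl
length-increasingPairs (inside  ∷ S) = begin
  length (map _ (elements S) ++ map _ (increasingPairs S))
    ≡⟨ length-++ (map _ (elements S)) ⟩
  length (map _ (elements S)) + length (map _ (increasingPairs S))
    ≡⟨ cong₂ _+_ (length-map _ (elements S)) (length-map _ (increasingPairs S)) ⟩
  length (elements S) + length (increasingPairs S)
    ≡⟨ cong₂ _+_ (trans (length-elements S) (sym (nC1≡n ∣ S ∣))) (length-increasingPairs S) ⟩
  ∣ S ∣ C 1 + ∣ S ∣ C 2
    ≡⟨ nCk+nC[k+1]≡[n+1]C[k+1] ∣ S ∣ 1 ⟩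
  suc ∣ S ∣ C 2 ∎
  where open ≡-Reasoning
length-increasingPairs (outside ∷ S) = trans (length-map _ (increasingPairs S)) (length-increasingPairs S)

∈⇒∈increasingPairs : ∀ {n} {S : Subset n} {x y} → x ∈ S → y ∈ S → x <ᶠ y →
                     (x , y) ∈ₗ increasingPairs S
∈⇒∈increasingPairs {S = inside ∷ S} {Fin.zero} {Fin.suc y} here (there y∈S) _ =
  ++⁺ˡ (map⁺ (Any.map (cong (λ y → Fin.zero , Fin.suc y)) (∈⇒∈elements y∈S)))
∈⇒∈increasingPairs {S = inside ∷ S} {Fin.suc x} {Fin.suc y} (there x∈S) (there y∈S) (s≤s x<y) =
  ++⁺ʳ (map _ (elements S))
       (map⁺ (Any.map (cong (×.map Fin.suc Fin.suc)) (∈⇒∈increasingPairs x∈S y∈S x<y)))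
∈⇒∈increasingPairs {S = outside ∷ S} {Fin.suc x} {Fin.suc y} (there x∈S) (there y∈S) (s≤s x<y) =
  map⁺ (Any.map (cong (×.map Fin.suc Fin.suc)) (∈⇒∈increasingPairs x∈S y∈S x<y))

module _ {n} (G : Graph n) where

  vertices : ∀ {x y ℓ} → Walk G x y ℓ → List (Fin n)
  vertices (here x)           = x ∷ []
  vertices (step {x = x} _ w) = x ∷ vertices w

  length-vertices : ∀ {x y ℓ} (w : Walk G x y ℓ) → length (vertices w) ≡ suc ℓ
  length-vertices (here x)   = refl
  length-vertices (step _ w) = cong suc (length-vertices w)

  OnWalk⇒∈vertices : ∀ {v x y ℓ} {w : Walk G x y ℓ} → OnWalk G v w → v ∈ₗ vertices w
  OnWalk⇒∈vertices on-here        = here refl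
  OnWalk⇒∈vertices (on-head _ _)  = here refl
  OnWalk⇒∈vertices (on-there _ p) = there (OnWalk⇒∈vertices p)

  geodesic-len≤diam : ∀ {D x y} → IsDiameter G D → (p : Geodesic G x y) → Geodesic.len p ≤ D
  geodesic-len≤diam (bounded , _) p = bounded _ _ _ (Geodesic.walk p , Geodesic.shortest p)

  module _ {S : Subset n} (g : ∀ x y → x ∈ S → y ∈ S → x <ᶠ y → Geodesic G x y) where

    chosenPathVertices : Fin n × Fin n → List (Fin n)
    chosenPathVertices (x , y) with x ∈? S | y ∈? S | x <ᶠ? y
    ... | yes x∈S | yes y∈S | yes x<y = vertices (Geodesic.walk (g x y x∈S y∈S x<y))
    ... | _       | _       | _       = []

    OnWalk⇒∈chosenPathVertices : ∀ {v x y} (x∈S : x ∈ S) (y∈S : y ∈ S) (x<y : x <ᶠ y) →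
      OnWalk G v (Geodesic.walk (g x y x∈S y∈S x<y)) → v ∈ₗ chosenPathVertices (x , y)
    OnWalk⇒∈chosenPathVertices {x = x} {y} x∈S y∈S x<y on with x ∈? S | y ∈? S | x <ᶠ? y
    ... | yes x∈S′ | yes y∈S′ | yes x<y′
      rewrite []=-irrelevant x∈S′ x∈S | []=-irrelevant y∈S′ y∈S | <ᶠ-irrelevant x<y′ x<y =
      OnWalk⇒∈vertices on
    ... | no x∉S | _       | _       = contradiction x∈S x∉S
    ... | yes _  | no y∉S  | _       = contradiction y∈S y∉S
    ... | yes _  | yes _   | no x≮y  = contradiction x<y x≮y

    length-chosenPathVertices≤ : ∀ {D} → IsDiameter G D → ∀ p → length (chosenPathVertices p) ≤ suc D
    length-chosenPathVertices≤ diam (x , y) with x ∈? S | y ∈? S | x <ᶠ? y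
    ... | yes x∈S | yes y∈S | yes x<y = let p = g x y x∈S y∈S x<y in
      ≤-trans (≤-reflexive (length-vertices (Geodesic.walk p))) (s≤s (geodesic-len≤diam diam p))
    ... | no _  | _     | _     = z≤n
    ... | yes _ | no _  | _     = z≤n
    ... | yes _ | yes _ | no _  = z≤n

  strongGeodetic⇒n≤∣S∣C2*[1+D] : ∀ {D S} → IsDiameter G D → IsStrongGeodetic G S →
                                 n ≤ (∣ S ∣ C 2) * suc D
  strongGeodetic⇒n≤∣S∣C2*[1+D] {D} {S} diam (g , covers) = begin
    n                                      ≤⟨ enumeration⇒n≤length covered covered-enumerates ⟩
    length covered                         ≤⟨ length-concatMap-≤ (chosenPathVertices g)
                                                (length-chosenPathVertices≤ g diam) (increasingPairs S) ⟩
    length (increasingPairs S) * suc D     ≡⟨ cong (_* suc D) (length-increasingPairs S) ⟩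
    (∣ S ∣ C 2) * suc D                    ∎
    where
    open ≤-Reasoning
    covered : List (Fin n)
    covered = concatMap (chosenPathVertices g) (increasingPairs S)
    covered-enumerates : ∀ v → v ∈ₗ covered
    covered-enumerates v with covers v
    ... | x , y , x∈S , y∈S , x<y , on = ∈-concatMap⁺ (chosenPathVertices g)
      (Any.map (λ { refl → OnWalk⇒∈chosenPathVertices g x∈S y∈S x<y on })
               (∈⇒∈increasingPairs x∈S y∈S x<y))

proposition3p3 : ∀ {n : ℕ} (G : Graph n) → 2 ≤ n → Connected G →
    ∀ D → IsDiameter G D → ∀ k → IsSG G k → ceilBound n D ≤ k
proposition3p3 {n} G 2≤n _ D diam k ((S , S-sg , ∣S∣≡k) , _) =
  ceilBound-minimal {n} (n≤kC2*[1+D]⇒AboveBound k (<-≤-trans (s≤s z≤n) 2≤n)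
    (subst (λ s → n ≤ (s C 2) * suc D) ∣S∣≡k (strongGeodetic⇒n≤∣S∣C2*[1+D] G diam S-sg)))
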